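{- (1) The complete graph $K_n$ is a DTDP-graph for every $n\ge 3$, but $K_n$ is a minimal DTDP-graph only if $n=3$. (2) The path $P_n$ on $n$ vertices is a DTDP-graph if and only if $n\in\mathbb{N}\setminus\{1,2,3,5,6,9\}$, but $P_n$ is a minimal DTDP-graph only if $n\in\{4,7,10,13\}$. (3) The cycle $C_n$ on $n$ vertices is a DTDP-graph if $n\ge 3$ and $n\neq 5$, while $C_n$ is a minimal DTDP-graph if and only if $n\in\{3,6,9\}$.
   Context: For a vertex $v$ of a graph $G$, $N_G(v)$ is the set of vertices adjacent to $v$. A set $D\subseteq V_G$ is dominating if every vertex not in $D$ has a neighbour in $D$; a set $T\subseteq V_G$ is total dominating if every vertex of $G$ (including those in $T$) has a neighbour in $T$. A DT-pair of $G$ is a pair $(D,T)$ of disjoint vertex sets such that $D$ is dominating and $T$ is total dominating; $G$ is a DTDP-graph if it has a DT-pair. A connected graph $G$ is a minimal DTDP-graph if it is a DTDP-graph and no proper spanning subgraph of $G$ (same vertex set, proper subset of the edges) is a DTDP-graph. -}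

module Defs where

open import Data.Nat using (ℕ; zero; suc; _≡ᵇ_)
open import Data.Fin using (Fin; toℕ; _≟_)
open import Data.Fin.Subset using (Subset; _∈_; _∉_)
open import Data.Bool using (Bool; true; false; _∧_; _∨_; not)
open import Data.Bool.Properties using (∨-comm; ∧-zeroʳ)
open import Data.Product using (Σ; ∃; ∃-syntax; _×_; _,_)
open import Relation.Nullary using (¬_; yes; no)
open import Relation.Nullary.Decidable using (⌊_⌋)
open import Relation.Binary.PropositionalEquality using (_≡_; refl; sym; cong₂)

record Graph (n : ℕ) : Set where
  field
    adj    : Fin n → Fin n → Bool
    adjSym : ∀ u v → adj u v ≡ adj v u
    adjIrr : ∀ v → adj v v ≡ false
open Graph public

Adjacent : ∀ {n} → Graph n → Fin n → Fin n → Set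
Adjacent G u v = adj G u v ≡ true

private
  neq : ∀ {n} → Fin n → Fin n → Bool
  neq u v = not ⌊ u ≟ v ⌋

  neq-sym : ∀ {n} (u v : Fin n) → neq u v ≡ neq v u
  neq-sym u v with u ≟ v | v ≟ u
  ... | yes _ | yes _ = refl
  ... | no _  | no _  = refl
  ... | yes p | no ¬q = Data.Empty.⊥-elim (¬q (sym p)) where import Data.Empty
  ... | no ¬p | yes q = Data.Empty.⊥-elim (¬p (sym q)) where import Data.Empty

  neq-refl : ∀ {n} (v : Fin n) → neq v v ≡ false
  neq-refl v with v ≟ v
  ... | yes _ = refl
  ... | no ¬p = Data.Empty.⊥-elim (¬p refl) where import Data.Empty

mkGraph : ∀ {n} → (Fin n → Fin n → Bool) → Graph n
adj (mkGraph r) u v = (r u v ∨ r v u) ∧ neq u v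
adjSym (mkGraph r) u v = cong₂ _∧_ (∨-comm (r u v) (r v u)) (neq-sym u v)
adjIrr (mkGraph r) v = ∧-zeroʳ' where
  ∧-zeroʳ' : (r v v ∨ r v v) ∧ neq v v ≡ false
  ∧-zeroʳ' rewrite neq-refl v = ∧-zeroʳ (r v v ∨ r v v)

completeGraph : (n : ℕ) → Graph n
completeGraph n = mkGraph (λ _ _ → true)

pathGraph : (n : ℕ) → Graph n
pathGraph n = mkGraph (λ u v → suc (toℕ u) ≡ᵇ toℕ v)

-- Cycle C_n (meaningful for n ≥ 3): edges {i,i+1} and {n-1,0}
cycleGraph : (n : ℕ) → Graph n
cycleGraph n = mkGraph (λ u v → (suc (toℕ u) ≡ᵇ toℕ v) ∨ ((suc (toℕ u) ≡ᵇ n) ∧ (toℕ v ≡ᵇ 0)))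

Dominating : ∀ {n} → Graph n → Subset n → Set
Dominating G D = ∀ v → v ∉ D → ∃[ u ] (u ∈ D × Adjacent G v u)

TotalDominating : ∀ {n} → Graph n → Subset n → Set
TotalDominating G T = ∀ v → ∃[ u ] (u ∈ T × Adjacent G v u)

Disjoint : ∀ {n} → Subset n → Subset n → Set
Disjoint D T = ∀ v → v ∈ D → v ∉ T

IsDTPair : ∀ {n} → Graph n → Subset n → Subset n → Set
IsDTPair G D T = Disjoint D T × Dominating G D × TotalDominating G T

IsDTDP : ∀ {n} → Graph n → Set
IsDTDP {n} G = Σ (Subset n) λ D → Σ (Subset n) λ T → IsDTPair G D T

data Reachable {n} (G : Graph n) : Fin n → Fin n → Set where
  here : ∀ {u} → Reachable G u u
  step : ∀ {u w v} → Adjacent G u w → Reachable G w v → Reachable G u v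

Connected : ∀ {n} → Graph n → Set
Connected {n} G = ∀ (u v : Fin n) → Reachable G u v

ProperSpanningSubgraph : ∀ {n} → Graph n → Graph n → Set
ProperSpanningSubgraph H G =
  (∀ u v → Adjacent H u v → Adjacent G u v) ×
  ∃[ u ] ∃[ v ] (Adjacent G u v × ¬ Adjacent H u v)

MinimalDTDP : ∀ {n} → Graph n → Set
MinimalDTDP {n} G =
  Connected G × IsDTDP G ×
  (∀ (H : Graph n) → ProperSpanningSubgraph H G → ¬ IsDTDP H)

-- A DT-pair (D , T) can be enlarged to (∁ T , T), so a graph is a DTDP-graph
-- exactly when it has a total dominating set with dominating complement (a
-- DT-split).  DT-splits survive adding edges and taking disjoint unions.  Hence
-- P_{a+b} has one whenever P_a and P_b do, and is then not minimal: deleting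
-- the edge between the two halves leaves P_a + P_b.  Starting from P_4, P_7,
-- P_10 and P_13 this settles all paths.  Likewise C_n is not minimal once P_n,
-- which is C_n minus an edge, is a DTDP-graph, and K_n (n ≥ 4) keeps a
-- DT-split after deleting an edge.  The remaining small cases are settled by
-- exhaustive search; for minimality it suffices to delete single edges.
module Submission where

open import Defs
open import Data.Bool using (Bool; true; false; _∧_; _∨_; not)
open import Data.Bool.Properties using (∧-identityʳ; ∧-zeroʳ; ∨-zeroʳ; T-≡)
  renaming (_≟_ to _≟ᵇ_)
open import Data.Fin using (Fin; zero; suc; toℕ; _≟_; _↑ˡ_; _↑ʳ_; fromℕ; fromℕ<)
open import Data.Fin.Properties
  using ( all?; any?; suc-injective; toℕ<n; toℕ-↑ˡ; toℕ-↑ʳ; toℕ-fromℕ; toℕ-fromℕ<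
        ; ↑ˡ-injective; ↑ʳ-injective)
open import Data.Fin.Subset using (Subset; _∈_; _∉_; ∁; outside; ⊤)
open import Data.Fin.Subset.Properties
  using (_∈?_; anySubset?; ∈⊤; x∈∁p⇒x∉p; x∉p⇒x∈∁p; x∉∁p⇒x∈p)
open import Data.Nat using (ℕ; zero; suc; _+_; _%_; _≡ᵇ_; _≤_; s≤s; z≤n; z<s)
open import Data.Nat.Properties
  using (≡ᵇ⇒≡; ≡⇒≡ᵇ; <⇒≢; +-suc; m+1+n≢m; m≢1+n+m; 1+n≢n; m≤m+n; m<m+n)
  renaming (_≟_ to _≟ℕ_)
open import Data.Product using (Σ; ∃-syntax; _×_; _,_; proj₁; proj₂; map; map₂)
open import Data.Sum using (_⊎_; inj₁; inj₂)
import Data.Sum as Sum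
open import Data.Vec using (_∷_; []; _++_; tabulate; here; there)
open import Data.Vec.Properties using (map-++)
open import Function using (_∘_; id; Equivalence)
open import Function.Definitions using (Injective)
open import Relation.Binary.PropositionalEquality
  using (_≡_; _≢_; refl; sym; trans; cong; subst)
open import Relation.Nullary using (¬_; Dec; yes; no; ¬?; contradiction)
open import Relation.Nullary.Decidable
  using ( ⌊_⌋; _×-dec_; _→-dec_; _⊎-dec_; from-yes; from-no
        ; True; False; toWitness; toWitnessFalse)
open import Relation.Unary using (Decidable)

private
  variable
    a b m n : ℕ

∧-true⁻ : ∀ {x y} → x ∧ y ≡ true → x ≡ true × y ≡ true
∧-true⁻ {true} {true} _ = refl , refl

≡ᵇ-true : ∀ {m n} → m ≡ n → (m ≡ᵇ n) ≡ true
≡ᵇ-true {m} {n} = Equivalence.to T-≡ ∘ ≡⇒≡ᵇ m n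

≡ᵇ-true⁻ : ∀ {m n} → (m ≡ᵇ n) ≡ true → m ≡ n
≡ᵇ-true⁻ {m} {n} = ≡ᵇ⇒≡ m n ∘ Equivalence.from T-≡

≢⇒not≡ᵇ : ∀ {m n} → m ≢ n → not (m ≡ᵇ n) ≡ true
≢⇒not≡ᵇ {m} {n} m≢n with m ≡ᵇ n in eq
... | true  = contradiction (≡ᵇ-true⁻ eq) m≢n
... | false = refl

not≡ᵇ⇒≢ : ∀ {m n} → not (m ≡ᵇ n) ≡ true → m ≢ n
not≡ᵇ⇒≢ e m≡n = contradiction (trans (sym (cong not (≡ᵇ-true m≡n))) e) λ ()

BoolRel : ℕ → Set
BoolRel n = Fin n → Fin n → Bool

Edge : BoolRel n → Fin n → Fin n → Set
Edge r u v = r u v ≡ true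

EdgePreserving : BoolRel m → BoolRel n → (Fin m → Fin n) → Set
EdgePreserving r s f = ∀ x y → Edge r x y → Edge s (f x) (f y)

_⊆ᴱ_ : BoolRel n → BoolRel n → Set
r ⊆ᴱ s = EdgePreserving r s id

Dominates : BoolRel n → Subset n → Set
Dominates r D = ∀ v → v ∉ D → ∃[ u ] (u ∈ D × Edge r v u)

TotallyDominates : BoolRel n → Subset n → Set
TotallyDominates r T = ∀ v → ∃[ u ] (u ∈ T × Edge r v u)

IsDTSplit : BoolRel n → Subset n → Set
IsDTSplit r T = TotallyDominates r T × Dominates r (∁ T)

DTSplit : BoolRel n → Set
DTSplit {n} r = Σ (Subset n) (IsDTSplit r)

IsDTDP⇒DTSplit : (G : Graph n) → IsDTDP G → DTSplit (adj G)
IsDTDP⇒DTSplit _ (D , T , disjoint , dom , tot) = T , tot , dom′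
  where
  dom′ : Dominates _ (∁ T)
  dom′ v v∉∁T with dom v (λ v∈D → disjoint v v∈D (x∉∁p⇒x∈p v∉∁T))
  ... | u , u∈D , e = u , x∉p⇒x∈∁p (disjoint u u∈D) , e

DTSplit⇒IsDTDP : (G : Graph n) → DTSplit (adj G) → IsDTDP G
DTSplit⇒IsDTDP _ (T , tot , dom) = ∁ T , T , (λ _ → x∈∁p⇒x∉p) , dom , tot

totallyDominates? : (r : BoolRel n) → Decidable (TotallyDominates r)
totallyDominates? r T = all? λ v → any? λ u → (u ∈? T) ×-dec (r v u ≟ᵇ true)

dominates? : (r : BoolRel n) → Decidable (Dominates r)
dominates? r D = all? λ v → ¬? (v ∈? D) →-dec any? λ u → (u ∈? D) ×-dec (r v u ≟ᵇ true)

isDTSplit? : (r : BoolRel n) → Decidable (IsDTSplit r)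
isDTSplit? r T = totallyDominates? r T ×-dec dominates? r (∁ T)

dtSplit? : (r : BoolRel n) → Dec (DTSplit r)
dtSplit? r = anySubset? (isDTSplit? r)

DTSplit-by-search : (G : Graph n) → {True (dtSplit? (adj G))} → DTSplit (adj G)
DTSplit-by-search G {found} = toWitness found

¬DTSplit-by-search : (G : Graph n) → {False (dtSplit? (adj G))} → ¬ DTSplit (adj G)
¬DTSplit-by-search G {none} = toWitnessFalse none

DTSplit-mono : {r s : BoolRel n} → r ⊆ᴱ s → DTSplit r → DTSplit s
DTSplit-mono r⊆s (T , tot , dom) =
  T , (λ v → map₂ (map₂ (r⊆s v _)) (tot v)) , (λ v v∉ → map₂ (map₂ (r⊆s v _)) (dom v v∉))

↑-elim : ∀ a {b} (P : Fin (a + b) → Set) →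
         (∀ x → P (x ↑ˡ b)) → (∀ y → P (a ↑ʳ y)) → ∀ v → P v
↑-elim zero    P left right v       = right v
↑-elim (suc a) P left right zero    = left zero
↑-elim (suc a) P left right (suc v) = ↑-elim a (P ∘ suc) (left ∘ suc) right v

∈-++⁺ˡ : {p : Subset m} {q : Subset n} {x : Fin m} → x ∈ p → (x ↑ˡ n) ∈ (p ++ q)
∈-++⁺ˡ here        = here
∈-++⁺ˡ (there x∈p) = there (∈-++⁺ˡ x∈p)

∈-++⁺ʳ : (p : Subset m) {q : Subset n} {y : Fin n} → y ∈ q → (m ↑ʳ y) ∈ (p ++ q)
∈-++⁺ʳ []      y∈q = y∈q
∈-++⁺ʳ (_ ∷ p) y∈q = there (∈-++⁺ʳ p y∈q)

module _ {r : BoolRel a} {s : BoolRel b} {t : BoolRel (a + b)}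
         (left : EdgePreserving r t (_↑ˡ b)) (right : EdgePreserving s t (a ↑ʳ_))
         {p : Subset a} {q : Subset b} where

  totallyDominates-++ : TotallyDominates r p → TotallyDominates s q →
                        TotallyDominates t (p ++ q)
  totallyDominates-++ tp tq = ↑-elim a _
    (λ x → map (_↑ˡ b) (λ {u} → map ∈-++⁺ˡ (left x u)) (tp x))
    (λ y → map (a ↑ʳ_) (λ {u} → map (∈-++⁺ʳ p) (right y u)) (tq y))

  dominates-++ : Dominates r p → Dominates s q → Dominates t (p ++ q)
  dominates-++ dp dq = ↑-elim a _
    (λ x x∉ → map (_↑ˡ b) (λ {u} → map ∈-++⁺ˡ (left x u)) (dp x (x∉ ∘ ∈-++⁺ˡ)))
    (λ y y∉ → map (a ↑ʳ_) (λ {u} → map (∈-++⁺ʳ p) (right y u)) (dq y (y∉ ∘ ∈-++⁺ʳ p)))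

DTSplit-++ : {r : BoolRel a} {s : BoolRel b} {t : BoolRel (a + b)} →
             EdgePreserving r t (_↑ˡ b) → EdgePreserving s t (a ↑ʳ_) →
             DTSplit r → DTSplit s → DTSplit t
DTSplit-++ left right (p , tp , dp) (q , tq , dq) =
  p ++ q , totallyDominates-++ left right tp tq ,
  subst (Dominates _) (sym (map-++ not p q)) (dominates-++ left right dp dq)

mkGraph-edge⁻ : {r : BoolRel n} {x y : Fin n} →
                Adjacent (mkGraph r) x y → (Edge r x y ⊎ Edge r y x) × x ≢ y
mkGraph-edge⁻ {r = r} {x} {y} e with r x y | r y x | x ≟ y
... | true  | _     | no x≢y = inj₁ refl , x≢y
... | false | true  | no x≢y = inj₂ refl , x≢y
... | false | false | no _   = contradiction e λ ()
... | _     | _     | yes _  = contradiction (trans (sym (∧-zeroʳ _)) e) λ ()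

mkGraph-edge⁺ : {r : BoolRel n} {x y : Fin n} →
                Edge r x y ⊎ Edge r y x → x ≢ y → Adjacent (mkGraph r) x y
mkGraph-edge⁺ {r = r} {x} {y} e x≢y with x ≟ y
... | yes x≡y = contradiction x≡y x≢y
... | no _    = trans (∧-identityʳ _) (Sum.[ cong (_∨ r y x) , ryx⇒ ]′ e)
  where
  ryx⇒ : Edge r y x → r x y ∨ r y x ≡ true
  ryx⇒ ryx = trans (cong (r x y ∨_) ryx) (∨-zeroʳ _)

mkGraph-preserving : (r : BoolRel m) (s : BoolRel n) {f : Fin m → Fin n} →
                     Injective _≡_ _≡_ f → EdgePreserving r s f →
                     EdgePreserving (adj (mkGraph r)) (adj (mkGraph s)) f
mkGraph-preserving r s inj hom x y e with mkGraph-edge⁻ {r = r} e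
... | rxy , x≢y = mkGraph-edge⁺ {r = s} (Sum.map (hom x y) (hom y x) rxy) (x≢y ∘ inj)

Reachable-trans : {G : Graph n} {u v w : Fin n} →
                  Reachable G u v → Reachable G v w → Reachable G u w
Reachable-trans here       r′ = r′
Reachable-trans (step e r) r′ = step e (Reachable-trans r r′)

Reachable-sym : {G : Graph n} {u v : Fin n} → Reachable G u v → Reachable G v u
Reachable-sym here                         = here
Reachable-sym {G = G} (step {u} {w} e r) =
  Reachable-trans (Reachable-sym r) (step (trans (adjSym G w u) e) here)

Reachable-map : {G : Graph m} {H : Graph n} (f : Fin m → Fin n) →
                EdgePreserving (adj G) (adj H) f →
                {u v : Fin m} → Reachable G u v → Reachable H (f u) (f v)
Reachable-map f hom here               = here
Reachable-map f hom (step {u} {w} e r) = step (hom u w e) (Reachable-map f hom r)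

connected-from : {G : Graph n} (root : Fin n) → (∀ v → Reachable G root v) → Connected G
connected-from root reach u v = Reachable-trans (Reachable-sym (reach u)) (reach v)

Connected-mono : {G H : Graph n} → adj G ⊆ᴱ adj H → Connected G → Connected H
Connected-mono G⊆H conn u v = Reachable-map id G⊆H (conn u v)

-- Minimality

minimal⇒DTSplit : {G : Graph n} → MinimalDTDP G → DTSplit (adj G)
minimal⇒DTSplit {G = G} (_ , dtdp , _) = IsDTDP⇒DTSplit G dtdp

¬minimal-by-subgraph : {G H : Graph n} → ProperSpanningSubgraph H G → DTSplit (adj H) →
                       ¬ MinimalDTDP G
¬minimal-by-subgraph {H = H} sub split (_ , _ , minimal) =
  minimal H sub (DTSplit⇒IsDTDP H split)

deleteEdge : BoolRel n → Fin n → Fin n → BoolRel n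
deleteEdge r u v x y = r x y ∧ not ((⌊ x ≟ u ⌋ ∧ ⌊ y ≟ v ⌋) ∨ (⌊ x ≟ v ⌋ ∧ ⌊ y ≟ u ⌋))

subgraph⊆deleteEdge : {G H : Graph n} → adj H ⊆ᴱ adj G → {u v : Fin n} →
                      ¬ Adjacent H u v → adj H ⊆ᴱ deleteEdge (adj G) u v
subgraph⊆deleteEdge {H = H} H⊆G {u} {v} ¬uv x y e
  with x ≟ u | y ≟ v | x ≟ v | y ≟ u
... | yes refl | yes refl | _        | _        = contradiction e ¬uv
... | _        | _        | yes refl | yes refl = contradiction (trans (adjSym H u v) e) ¬uv
... | no _     | _        | no _     | _        = trans (∧-identityʳ _) (H⊆G x y e)
... | no _     | _        | yes _    | no _     = trans (∧-identityʳ _) (H⊆G x y e)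
... | yes _    | no _     | no _     | _        = trans (∧-identityʳ _) (H⊆G x y e)
... | yes _    | no _     | yes _    | no _     = trans (∧-identityʳ _) (H⊆G x y e)

EdgeCritical : Graph n → Set
EdgeCritical G = ∀ u v → Adjacent G u v → ¬ DTSplit (deleteEdge (adj G) u v)

edgeCritical? : (G : Graph n) → Dec (EdgeCritical G)
edgeCritical? G = all? λ u → all? λ v →
  (adj G u v ≟ᵇ true) →-dec ¬? (dtSplit? (deleteEdge (adj G) u v))

-- A proper spanning subgraph lies inside G minus one of the edges it misses.
minimalDTDP-intro : {G : Graph n} → Connected G → DTSplit (adj G) → EdgeCritical G →
                    MinimalDTDP G
minimalDTDP-intro {G = G} conn split critical =
  conn , DTSplit⇒IsDTDP G split ,
  λ H (H⊆G , u , v , uv , ¬uv) dtdp →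
    critical u v uv
      (DTSplit-mono (subgraph⊆deleteEdge {G = G} {H} H⊆G ¬uv) (IsDTDP⇒DTSplit H dtdp))

minimalDTDP-by-search : (G : Graph n) → Connected G →
                     {True (dtSplit? (adj G))} → {True (edgeCritical? G)} → MinimalDTDP G
minimalDTDP-by-search G conn {split} {critical} =
  minimalDTDP-intro conn (toWitness split) (toWitness critical)

-- Paths

succRel : BoolRel n
succRel u v = suc (toℕ u) ≡ᵇ toℕ v

pathGraph-connected : ∀ n → Connected (pathGraph n)
pathGraph-connected zero    = λ ()
pathGraph-connected (suc n) = connected-from zero (reach n)
  where
  shift : ∀ n → EdgePreserving (adj (pathGraph n)) (adj (pathGraph (suc n))) suc
  shift n = mkGraph-preserving succRel succRel suc-injective λ _ _ e → e
  reach : ∀ n (v : Fin (suc n)) → Reachable (pathGraph (suc n)) zero v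
  reach n       zero    = here
  reach (suc n) (suc v) = step refl (Reachable-map suc (shift (suc n)) (reach n v))

-- P_a and P_b side by side: the path P_{a+b} without its edge {a - 1, a}.
unionRel : ∀ a b → BoolRel (a + b)
unionRel a b u v = (suc (toℕ u) ≡ᵇ toℕ v) ∧ not (toℕ v ≡ᵇ a)

pathUnion : ∀ a b → Graph (a + b)
pathUnion a b = mkGraph (unionRel a b)

pathUnion-left : ∀ a b → EdgePreserving (adj (pathGraph a)) (adj (pathUnion a b)) (_↑ˡ b)
pathUnion-left a b =
  mkGraph-preserving succRel (unionRel a b) (λ {x} {y} → ↑ˡ-injective b x y) hom
  where
  hom : EdgePreserving succRel (unionRel a b) (_↑ˡ b)
  hom x y e rewrite toℕ-↑ˡ x b | toℕ-↑ˡ y b | e = ≢⇒not≡ᵇ (<⇒≢ (toℕ<n y))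

pathUnion-right : ∀ a b → EdgePreserving (adj (pathGraph b)) (adj (pathUnion a b)) (a ↑ʳ_)
pathUnion-right a b =
  mkGraph-preserving succRel (unionRel a b) (λ {x} {y} → ↑ʳ-injective a x y) hom
  where
  hom : EdgePreserving succRel (unionRel a b) (a ↑ʳ_)
  hom x y e rewrite toℕ-↑ʳ a x | toℕ-↑ʳ a y | sym (≡ᵇ-true⁻ {suc (toℕ x)} {toℕ y} e)
                  | ≡ᵇ-true (sym (+-suc a (toℕ x))) = ≢⇒not≡ᵇ (m+1+n≢m a)

pathUnion⊆pathGraph : ∀ a b → adj (pathUnion a b) ⊆ᴱ adj (pathGraph (a + b))
pathUnion⊆pathGraph a b = mkGraph-preserving (unionRel a b) succRel id λ _ _ → proj₁ ∘ ∧-true⁻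

pathUnion-proper : ∀ a b →
  ProperSpanningSubgraph (pathUnion (suc a) (suc b)) (pathGraph (suc a + suc b))
pathUnion-proper a b = pathUnion⊆pathGraph (suc a) (suc b) , u , v , bridge , ¬bridge
  where
  u v : Fin (suc a + suc b)
  u = fromℕ< (m≤m+n (suc a) (suc b))
  v = fromℕ< (m<m+n (suc a) z<s)
  u≡a : toℕ u ≡ a
  u≡a = toℕ-fromℕ< (m≤m+n (suc a) (suc b))
  v≡1+a : toℕ v ≡ suc a
  v≡1+a = toℕ-fromℕ< (m<m+n (suc a) {suc b} z<s)
  bridge : Adjacent (pathGraph (suc a + suc b)) u v
  bridge = mkGraph-edge⁺ {r = succRel} {u} {v}
    (inj₁ (≡ᵇ-true (trans (cong suc u≡a) (sym v≡1+a))))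
    λ u≡v → 1+n≢n (trans (sym v≡1+a) (trans (cong toℕ (sym u≡v)) u≡a))
  ¬bridge : ¬ Adjacent (pathUnion (suc a) (suc b)) u v
  ¬bridge e with proj₁ (mkGraph-edge⁻ {r = unionRel (suc a) (suc b)} {u} {v} e)
  ... | inj₁ uv = not≡ᵇ⇒≢ (proj₂ (∧-true⁻ {suc (toℕ u) ≡ᵇ toℕ v} uv)) v≡1+a
  ... | inj₂ vu = m≢1+n+m a (sym (trans (cong suc (sym v≡1+a)) (trans 2+a≡u u≡a)))
    where
    2+a≡u : suc (toℕ v) ≡ toℕ u
    2+a≡u = ≡ᵇ-true⁻ (proj₁ (∧-true⁻ vu))

DTSplit-pathUnion : ∀ a b → DTSplit (adj (pathGraph a)) → DTSplit (adj (pathGraph b)) →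
                    DTSplit (adj (pathUnion a b))
DTSplit-pathUnion a b = DTSplit-++ (pathUnion-left a b) (pathUnion-right a b)

pathGraph-DTSplit-+ : ∀ a b → DTSplit (adj (pathGraph a)) → DTSplit (adj (pathGraph b)) →
                      DTSplit (adj (pathGraph (a + b)))
pathGraph-DTSplit-+ a b pa pb =
  DTSplit-mono (pathUnion⊆pathGraph a b) (DTSplit-pathUnion a b pa pb)

pathGraph-¬minimal-+ : ∀ a b → DTSplit (adj (pathGraph (suc a))) →
                       DTSplit (adj (pathGraph (suc b))) →
                       ¬ MinimalDTDP (pathGraph (suc a + suc b))
pathGraph-¬minimal-+ a b pa pb =
  ¬minimal-by-subgraph {H = pathUnion (suc a) (suc b)} (pathUnion-proper a b)
    (DTSplit-pathUnion (suc a) (suc b) pa pb)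

Exceptional : ℕ → Set
Exceptional n = n ≡ 1 ⊎ n ≡ 2 ⊎ n ≡ 3 ⊎ n ≡ 5 ⊎ n ≡ 6 ⊎ n ≡ 9

exceptional? : Decidable Exceptional
exceptional? n =
  (n ≟ℕ 1) ⊎-dec (n ≟ℕ 2) ⊎-dec (n ≟ℕ 3) ⊎-dec (n ≟ℕ 5) ⊎-dec (n ≟ℕ 6) ⊎-dec (n ≟ℕ 9)

MinimalLength : ℕ → Set
MinimalLength n = n ≡ 4 ⊎ n ≡ 7 ⊎ n ≡ 10 ⊎ n ≡ 13

minimalLength? : Decidable MinimalLength
minimalLength? n = (n ≟ℕ 4) ⊎-dec (n ≟ℕ 7) ⊎-dec (n ≟ℕ 10) ⊎-dec (n ≟ℕ 13)

data PathLengthView : ℕ → Set where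
  exceptional : Exceptional n → PathLengthView n
  base        : MinimalLength n → PathLengthView n
  extension   : ∀ m → ¬ Exceptional (suc m) → PathLengthView (4 + suc m)

pattern 4+_ m = suc (suc (suc (suc m)))

pathLengthView : ∀ n → 1 ≤ n → PathLengthView n
pathLengthView 1  _ = exceptional (from-yes (exceptional? 1))
pathLengthView 2  _ = exceptional (from-yes (exceptional? 2))
pathLengthView 3  _ = exceptional (from-yes (exceptional? 3))
pathLengthView 4  _ = base (from-yes (minimalLength? 4))
pathLengthView 5  _ = exceptional (from-yes (exceptional? 5))
pathLengthView 6  _ = exceptional (from-yes (exceptional? 6))
pathLengthView 7  _ = base (from-yes (minimalLength? 7))
pathLengthView 8  _ = extension 3 (from-no (exceptional? 4))
pathLengthView 9  _ = exceptional (from-yes (exceptional? 9))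
pathLengthView 10 _ = base (from-yes (minimalLength? 10))
pathLengthView 11 _ = extension 6 (from-no (exceptional? 7))
pathLengthView 12 _ = extension 7 (from-no (exceptional? 8))
pathLengthView 13 _ = base (from-yes (minimalLength? 13))
pathLengthView (4+ (suc m@(4+ (4+ (suc _))))) _ = extension m (from-no (exceptional? (suc m)))

thirdsOmitted : ∀ n → Subset n
thirdsOmitted n = tabulate λ i → not (toℕ i % 3 ≡ᵇ 0)

thirdsSplit : ∀ n → {True (isDTSplit? (adj (pathGraph n)) (thirdsOmitted n))} →
              DTSplit (adj (pathGraph n))
thirdsSplit n {ok} = thirdsOmitted n , toWitness ok

pathGraph-DTSplit-minimalLength : MinimalLength n → DTSplit (adj (pathGraph n))
pathGraph-DTSplit-minimalLength (inj₁ refl)               = thirdsSplit 4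
pathGraph-DTSplit-minimalLength (inj₂ (inj₁ refl))        = thirdsSplit 7
pathGraph-DTSplit-minimalLength (inj₂ (inj₂ (inj₁ refl))) = thirdsSplit 10
pathGraph-DTSplit-minimalLength (inj₂ (inj₂ (inj₂ refl))) = thirdsSplit 13

pathGraph-DTSplit : ∀ n → ¬ Exceptional n → DTSplit (adj (pathGraph n))
pathGraph-DTSplit zero _ = DTSplit-by-search (pathGraph 0)
pathGraph-DTSplit n@(suc _) ¬e with pathLengthView n (s≤s z≤n)
... | exceptional e   = contradiction e ¬e
... | base ℓ          = pathGraph-DTSplit-minimalLength ℓ
... | extension m ¬e′ =
  pathGraph-DTSplit-+ 4 (suc m) (thirdsSplit 4) (pathGraph-DTSplit (suc m) ¬e′)

pathGraph-¬DTSplit : ∀ n → Exceptional n → ¬ DTSplit (adj (pathGraph n))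
pathGraph-¬DTSplit n (inj₁ refl)                           = ¬DTSplit-by-search (pathGraph n)
pathGraph-¬DTSplit n (inj₂ (inj₁ refl))                    = ¬DTSplit-by-search (pathGraph n)
pathGraph-¬DTSplit n (inj₂ (inj₂ (inj₁ refl)))             = ¬DTSplit-by-search (pathGraph n)
pathGraph-¬DTSplit n (inj₂ (inj₂ (inj₂ (inj₁ refl))))      = ¬DTSplit-by-search (pathGraph n)
pathGraph-¬DTSplit n (inj₂ (inj₂ (inj₂ (inj₂ (inj₁ refl))))) = ¬DTSplit-by-search (pathGraph n)
pathGraph-¬DTSplit n (inj₂ (inj₂ (inj₂ (inj₂ (inj₂ refl))))) = ¬DTSplit-by-search (pathGraph n)

pathGraph-minimal⇒ : ∀ n → 1 ≤ n → MinimalDTDP (pathGraph n) → MinimalLength n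
pathGraph-minimal⇒ n 1≤n minimal with pathLengthView n 1≤n
... | exceptional e   = contradiction (minimal⇒DTSplit minimal) (pathGraph-¬DTSplit n e)
... | base ℓ          = ℓ
... | extension m ¬e  =
  contradiction minimal
    (pathGraph-¬minimal-+ 3 m (thirdsSplit 4) (pathGraph-DTSplit (suc m) ¬e))

-- Complete graphs

completeGraph-DTSplit : ∀ n → 3 ≤ n → DTSplit (adj (completeGraph n))
completeGraph-DTSplit (suc (suc (suc k))) (s≤s (s≤s (s≤s _))) = outside ∷ ⊤ , tot , dom
  where
  tot : TotallyDominates (adj (completeGraph (3 + k))) (outside ∷ ⊤)
  tot zero          = suc zero , there ∈⊤ , refl
  tot (suc zero)    = suc (suc zero) , there ∈⊤ , refl
  tot (suc (suc v)) = suc zero , there ∈⊤ , refl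
  dom : Dominates (adj (completeGraph (3 + k))) (∁ (outside ∷ ⊤))
  dom zero    v∉ = contradiction here v∉
  dom (suc v) _  = zero , here , refl

-- K_n without the edge {0, 1}.
completeMinusEdge : ∀ n → Graph n
completeMinusEdge n = mkGraph λ u v → not ((toℕ u + toℕ v) ≡ᵇ 1)

completeMinusEdge-DTSplit : ∀ k → DTSplit (adj (completeMinusEdge (4 + k)))
completeMinusEdge-DTSplit k = outside ∷ outside ∷ ⊤ , tot , dom
  where
  tot : TotallyDominates (adj (completeMinusEdge (4 + k))) (outside ∷ outside ∷ ⊤)
  tot zero                = suc (suc zero) , there (there ∈⊤) , refl
  tot (suc zero)          = suc (suc zero) , there (there ∈⊤) , refl
  tot (suc (suc zero))    = suc (suc (suc zero)) , there (there ∈⊤) , refl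
  tot (suc (suc (suc v))) = suc (suc zero) , there (there ∈⊤) , refl
  dom : Dominates (adj (completeMinusEdge (4 + k))) (∁ (outside ∷ outside ∷ ⊤))
  dom zero          v∉ = contradiction here v∉
  dom (suc zero)    v∉ = contradiction (there here) v∉
  dom (suc (suc v)) _  = zero , here , refl

completeGraph-minimal⇒ : ∀ n → 3 ≤ n → MinimalDTDP (completeGraph n) → n ≡ 3
completeGraph-minimal⇒ 1      (s≤s ())       _
completeGraph-minimal⇒ 2      (s≤s (s≤s ())) _
completeGraph-minimal⇒ 3      _              _       = refl
completeGraph-minimal⇒ (4+ k) _              minimal =
  contradiction minimal
    (¬minimal-by-subgraph {H = completeMinusEdge (4 + k)} proper (completeMinusEdge-DTSplit k))
  where
  proper : ProperSpanningSubgraph (completeMinusEdge (4 + k)) (completeGraph (4 + k))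
  proper =
    mkGraph-preserving (λ u v → not ((toℕ u + toℕ v) ≡ᵇ 1)) (λ _ _ → true) id (λ _ _ _ → refl) ,
    zero , suc zero , refl , λ ()

-- Cycles

wrapRel : ∀ n → BoolRel n
wrapRel n u v = (suc (toℕ u) ≡ᵇ n) ∧ (toℕ v ≡ᵇ 0)

cycleRel : ∀ n → BoolRel n
cycleRel n u v = succRel u v ∨ wrapRel n u v

pathGraph⊆cycleGraph : ∀ n → adj (pathGraph n) ⊆ᴱ adj (cycleGraph n)
pathGraph⊆cycleGraph n =
  mkGraph-preserving succRel (cycleRel n) id λ x y e → cong (_∨ wrapRel n x y) e

cycleGraph-connected : ∀ n → Connected (cycleGraph n)
cycleGraph-connected n = Connected-mono (pathGraph⊆cycleGraph n) (pathGraph-connected n)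

cycleGraph-¬minimal : ∀ n → 3 ≤ n → DTSplit (adj (pathGraph n)) → ¬ MinimalDTDP (cycleGraph n)
cycleGraph-¬minimal (suc (suc (suc k))) (s≤s (s≤s (s≤s _))) =
  ¬minimal-by-subgraph {H = pathGraph (3 + k)}
    (pathGraph⊆cycleGraph (3 + k) , zero , last , closing , λ ())
  where
  last : Fin (3 + k)
  last = fromℕ (2 + k)
  closing : Adjacent (cycleGraph (3 + k)) zero last
  closing = mkGraph-edge⁺ {r = cycleRel (3 + k)} {zero} {last}
              (inj₂ (cong (_∧ true) (≡ᵇ-true (toℕ-fromℕ k)))) λ ()

exceptional-≥3 : Exceptional n → 3 ≤ n → n ≡ 3 ⊎ n ≡ 5 ⊎ n ≡ 6 ⊎ n ≡ 9
exceptional-≥3 (inj₁ refl)        (s≤s ())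
exceptional-≥3 (inj₂ (inj₁ refl)) (s≤s (s≤s ()))
exceptional-≥3 (inj₂ (inj₂ e))    _ = e

cycleGraph-DTSplit : ∀ n → 3 ≤ n → n ≢ 5 → DTSplit (adj (cycleGraph n))
cycleGraph-DTSplit n 3≤n n≢5 with exceptional? n
... | no ¬e = DTSplit-mono (pathGraph⊆cycleGraph n) (pathGraph-DTSplit n ¬e)
... | yes e with exceptional-≥3 e 3≤n
...   | inj₁ refl               = DTSplit-by-search (cycleGraph 3)
...   | inj₂ (inj₁ refl)        = contradiction refl n≢5
...   | inj₂ (inj₂ (inj₁ refl)) = DTSplit-by-search (cycleGraph 6)
...   | inj₂ (inj₂ (inj₂ refl)) = DTSplit-by-search (cycleGraph 9)

cycleGraph-minimal⇒ : ∀ n → 3 ≤ n → MinimalDTDP (cycleGraph n) → n ≡ 3 ⊎ n ≡ 6 ⊎ n ≡ 9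
cycleGraph-minimal⇒ n 3≤n minimal with exceptional? n
... | no ¬e = contradiction minimal (cycleGraph-¬minimal n 3≤n (pathGraph-DTSplit n ¬e))
... | yes e with exceptional-≥3 e 3≤n
...   | inj₁ n≡3            = inj₁ n≡3
...   | inj₂ (inj₁ refl)    = contradiction (minimal⇒DTSplit minimal) (¬DTSplit-by-search (cycleGraph 5))
...   | inj₂ (inj₂ n≡6⊎n≡9) = inj₂ n≡6⊎n≡9

cycleGraph-minimal⇐ : ∀ n → n ≡ 3 ⊎ n ≡ 6 ⊎ n ≡ 9 → MinimalDTDP (cycleGraph n)
cycleGraph-minimal⇐ n (inj₁ refl) =
  minimalDTDP-by-search (cycleGraph n) (cycleGraph-connected n)
cycleGraph-minimal⇐ n (inj₂ (inj₁ refl)) =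
  minimalDTDP-by-search (cycleGraph n) (cycleGraph-connected n)
cycleGraph-minimal⇐ n (inj₂ (inj₂ refl)) =
  minimalDTDP-by-search (cycleGraph n) (cycleGraph-connected n)

mainTheorem1 :
  ((∀ n → 3 ≤ n → IsDTDP (completeGraph n)) ×
   (∀ n → 3 ≤ n → MinimalDTDP (completeGraph n) → n ≡ 3)) ×
  ((∀ n → 1 ≤ n →
      (IsDTDP (pathGraph n) → ¬ (n ≡ 1 ⊎ n ≡ 2 ⊎ n ≡ 3 ⊎ n ≡ 5 ⊎ n ≡ 6 ⊎ n ≡ 9)) ×
      (¬ (n ≡ 1 ⊎ n ≡ 2 ⊎ n ≡ 3 ⊎ n ≡ 5 ⊎ n ≡ 6 ⊎ n ≡ 9) → IsDTDP (pathGraph n))) ×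
   (∀ n → 1 ≤ n → MinimalDTDP (pathGraph n) → n ≡ 4 ⊎ n ≡ 7 ⊎ n ≡ 10 ⊎ n ≡ 13)) ×
  ((∀ n → 3 ≤ n → n ≢ 5 → IsDTDP (cycleGraph n)) ×
   (∀ n → 3 ≤ n →
      (MinimalDTDP (cycleGraph n) → n ≡ 3 ⊎ n ≡ 6 ⊎ n ≡ 9) ×
      (n ≡ 3 ⊎ n ≡ 6 ⊎ n ≡ 9 → MinimalDTDP (cycleGraph n))))
mainTheorem1 =
  ( (λ n 3≤n → DTSplit⇒IsDTDP (completeGraph n) (completeGraph-DTSplit n 3≤n))
  , completeGraph-minimal⇒ ) ,
  ( (λ n _ → (λ dtdp e → pathGraph-¬DTSplit n e (IsDTDP⇒DTSplit (pathGraph n) dtdp))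
           , (λ ¬e → DTSplit⇒IsDTDP (pathGraph n) (pathGraph-DTSplit n ¬e)))
  , pathGraph-minimal⇒ ) ,
  ( (λ n 3≤n n≢5 → DTSplit⇒IsDTDP (cycleGraph n) (cycleGraph-DTSplit n 3≤n n≢5))
  , (λ n 3≤n → cycleGraph-minimal⇒ n 3≤n , cycleGraph-minimal⇐ n) )
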